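{- Let $M$ be a boolean matrix representation of a simple simplicial complex $\mathcal{H}=(V,H)$ of dimension $2$. Then: (i) if $\Gamma M$ is connected or belongs to $\Omega_1\cup\Omega_2$, then $\Gamma\mathrm{Fl}\mathcal{H}$ is connected; (ii) in all other cases, $\Gamma\mathrm{Fl}\mathcal{H}=\Gamma M$.
   Context: A (finite) simplicial complex is a pair $(V,H)$ with $V$ finite nonempty and $H\subseteq 2^V$ containing all singletons and closed under subsets; it is simple if every 2-subset of $V$ is in $H$; dimension of a face $I$ is $|I|-1$, of the complex the maximum over faces. A boolean matrix with row set $R$ and column set $V$ is nonsingular if, after independently permuting rows and columns, it is square lower unitriangular; $X\subseteq V$ is $M$-independent if some submatrix $M[Y,X]$ is nonsingular; $M=(m_{rv})$ is a boolean matrix representation of $\mathcal{H}$ if $H$ is exactly the set of $M$-independent subsets. For a row $r$, $Z_r=\{v\in V: m_{rv}=0\}$; $Z_r$ is a line of $M$ if $2\leq|Z_r|<|V|$. $\Gamma M$ is the graph with vertex set $V$ and an edge $p - q$ whenever $\{p,q\}$ is a 2-subset of some line of $M$. A flat of $\mathcal{H}$ is a set $X\subseteq V$ with $I\cup\{p\}\in H$ for all $I\in H$, $I\subseteq X$, $p\in V\setminus X$; $\overline{X}$ is the intersection of flats containing $X$. $\Gamma\mathrm{Fl}\mathcal{H}$ has vertex set $V$ and edges $p - q$ for $p\neq q$ with $\overline{\{p,q\}}\neq V$. For disjoint graphs $\Gamma,\Gamma'$, the join $\Gamma+\Gamma'$ is their union together with all edges between a vertex of $\Gamma$ and a vertex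 of $\Gamma'$, and the coproduct $\Gamma\sqcup\Gamma'$ is their disjoint union. $K_n$ is the complete graph on $n$ vertices and $\overline{K_n}$ the edgeless graph on $n$ vertices. $\Omega_1$ is the class of graphs of the form $(\overline{K_n}+\Delta)\sqcup K_1$ with $n\geq 1$ and $\Delta$ any finite graph; $\Omega_2$ is the class of graphs of the form $(K_1+\Delta)\sqcup(K_1+\Delta')$ with $\Delta,\Delta'$ any finite graphs. -}

module Defs where

open import Data.Nat as ℕ using (ℕ; suc; _≤_)
open import Data.Bool using (Bool; true; false; not)
open import Data.Fin as Fin using (Fin)
open import Data.Fin.Subset using (Subset; _∈_; _∉_; _⊆_; ⁅_⁆; _∪_; ∣_∣; Nonempty)
open import Data.Vec using (tabulate)
open import Data.Product using (Σ; ∃; _×_; _,_)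
open import Data.Sum using (_⊎_)
open import Relation.Nullary using (¬_)
open import Relation.Binary.PropositionalEquality using (_≡_; _≢_)
open import Relation.Binary.Construct.Closure.ReflexiveTransitive using (Star)
open import Function.Definitions using (Injective)

record SimplicialComplex (n : ℕ) : Set₁ where
  field
    H          : Subset n → Set
    nonemptyV  : 1 ≤ n
    singletons : ∀ v → H ⁅ v ⁆
    downClosed : ∀ {X Y} → X ⊆ Y → H Y → H X
open SimplicialComplex public

IsSimple : ∀ {n} → SimplicialComplex n → Set
IsSimple K = ∀ p q → p ≢ q → H K (⁅ p ⁆ ∪ ⁅ q ⁆)

-- dimension of face I is |I| - 1; dimension of complex = max over faces
HasDimension : ∀ {n} → SimplicialComplex n → ℕ → Set
HasDimension K d = (∃ λ I → H K I × ∣ I ∣ ≡ suc d) × (∀ I → H K I → ∣ I ∣ ≤ suc d)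

BoolMatrix : ℕ → ℕ → Set
BoolMatrix m n = Fin m → Fin n → Bool

-- X is M-independent: some submatrix M[Y,X] is nonsingular, i.e. there are
-- enumerations y_0..y_{k-1} of Y (rows) and x_0..x_{k-1} of X (columns) such that
-- (M y_i x_j) is lower unitriangular.
MIndependent : ∀ {m n} → BoolMatrix m n → Subset n → Set
MIndependent {m} {n} M X =
  Σ ℕ λ k → Σ (Fin k → Fin m) λ f → Σ (Fin k → Fin n) λ g →
    Injective _≡_ _≡_ f × Injective _≡_ _≡_ g ×
    (∀ v → (v ∈ X → ∃ λ i → g i ≡ v) × ((∃ λ i → g i ≡ v) → v ∈ X)) ×
    (∀ i → M (f i) (g i) ≡ true) ×
    (∀ i j → i Fin.< j → M (f i) (g j) ≡ false)

Represents : ∀ {m n} → BoolMatrix m n → SimplicialComplex n → Set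
Represents M K = ∀ X → (H K X → MIndependent M X) × (MIndependent M X → H K X)

Zrow : ∀ {m n} → BoolMatrix m n → Fin m → Subset n
Zrow M r = tabulate λ v → not (M r v)

IsLine : ∀ {m n} → BoolMatrix m n → Fin m → Set
IsLine {n = n} M r = 2 ≤ ∣ Zrow M r ∣ × ∣ Zrow M r ∣ ℕ.< n

Graph : ℕ → Set₁
Graph n = Fin n → Fin n → Set

ΓM : ∀ {m n} → BoolMatrix m n → Graph n
ΓM M p q = p ≢ q × ∃ λ r → IsLine M r × p ∈ Zrow M r × q ∈ Zrow M r

IsFlat : ∀ {n} → SimplicialComplex n → Subset n → Set
IsFlat K X = ∀ I → H K I → I ⊆ X → ∀ p → p ∉ X → H K (I ∪ ⁅ p ⁆)

_∈cl[_]_ : ∀ {n} → Fin n → SimplicialComplex n → Subset n → Set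
v ∈cl[ K ] X = ∀ F → IsFlat K F → X ⊆ F → v ∈ F

ΓFl : ∀ {n} → SimplicialComplex n → Graph n
ΓFl K p q = p ≢ q × ¬ (∀ v → v ∈cl[ K ] (⁅ p ⁆ ∪ ⁅ q ⁆))

Connected : ∀ {n} → Graph n → Set
Connected E = ∀ p q → Star E p q

_≅_ : ∀ {n} → Graph n → Graph n → Set
E ≅ E' = ∀ p q → (E p q → E' p q) × (E' p q → E p q)

-- (K̄_a + Δ) ⊔ K_1 , a ≥ 1 : A is the independent set, z the isolated vertex,
-- the remaining vertices carry the arbitrary graph Δ.
Ω₁ : ∀ {n} → Graph n → Set
Ω₁ E = Σ _ λ z → Σ _ λ A →
  Nonempty A × z ∉ A ×
  (∀ v → ¬ E z v × ¬ E v z) ×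
  (∀ a b → a ∈ A → b ∈ A → ¬ E a b) ×
  (∀ a d → a ∈ A → d ∉ A → d ≢ z → E a d)

-- (K_1 + Δ) ⊔ (K_1 + Δ') : B and its complement, with centres b ∈ B and c ∉ B.
Ω₂ : ∀ {n} → Graph n → Set
Ω₂ E = Σ _ λ B → Σ _ λ b → Σ _ λ c →
  b ∈ B × c ∉ B ×
  (∀ u v → u ∈ B → v ∉ B → ¬ E u v × ¬ E v u) ×
  (∀ u → u ∈ B → u ≢ b → E b u) ×
  (∀ u → u ∉ B → u ≢ c → E c u)

-- Call F a covering anticlique of a graph if no two of its vertices are adjacent and
-- every vertex outside F is adjacent to all vertices of F but at most one.  For ΓM
-- these sets control the flats.  A covering anticlique is a flat: a face inside it
-- has at most two vertices, and a line through an outside vertex and one of them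
-- misses the other, so the three span a face.  Conversely, a proper flat containing
-- a nonadjacent pair of ΓM is a covering anticlique: a line through two of its
-- vertices contains all of it, since otherwise it spans a triangle inside the flat,
-- which a vertex outside the flat extends to a face of size four.  Hence a
-- nonadjacent pair of ΓM spans everything unless ΓM has a covering anticlique with
-- two vertices; such a graph is connected or lies in Ω₁ ∪ Ω₂ (according as F has an
-- isolated vertex, a third vertex, or is a pair), and conversely graphs in Ω₁ ∪ Ω₂
-- have one, which as a proper flat joins all vertices in ΓFl.

module Submission where

open import Defs
open import Data.Bool using (T; true; false)
open import Data.Bool.Properties using (T-≡; T-not-≡; ¬-not)
open import Data.Empty using (⊥-elim)
open import Data.Fin using (Fin; zero; suc; _≟_; _<_)
open import Data.Fin.Properties using (any?; all?; ¬∀⟶∃¬)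
open import Data.Fin.Subset
  using (Subset; _∈_; _∉_; _⊆_; ⁅_⁆; _∪_; _-_; ∣_∣; ⊤; Empty; inside; outside)
open import Data.Fin.Subset.Properties
open import Data.List using (List; []; _∷_; length)
open import Data.List.Relation.Unary.All as All using (All; []; _∷_)
open import Data.List.Relation.Unary.AllPairs using ([]; _∷_)
open import Data.List.Relation.Unary.Unique.Propositional using (Unique)
open import Data.Nat as ℕ using (ℕ; _≤_; z≤n; s≤s; _+_)
open import Data.Nat.Properties using (≤-trans; ≤-reflexive; ≤⇒≯; +-suc; +-monoʳ-≤; n≤1+n)
open import Data.Product using (∃; ∃₂; _×_; _,_; proj₁; proj₂)
open import Data.Sum using (_⊎_; inj₁; inj₂; [_,_])
open import Data.Vec using (tabulate; []; _∷_; there)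
open import Data.Vec.Properties using (lookup∘tabulate; []=⇒lookup; lookup⇒[]=)
import Data.Vec.Functional as Vector
open import Function using (_∘_; id; Equivalence)
open import Function.Definitions using (Injective)
open import Relation.Binary.Definitions using (Symmetric; Decidable)
open import Relation.Binary.PropositionalEquality using (_≡_; _≢_; refl; sym; trans; cong; cong₂; subst)
open import Relation.Binary.Construct.Closure.ReflexiveTransitive
  using (Star; ε; _◅_; _◅◅_; reverse)
  renaming (map to Star-map)
open import Relation.Nullary using (¬_; yes; no; isYes)
open import Relation.Nullary.Decidable
  using (_×-dec_; ¬?; decidable-stable; toWitness; fromWitness)

open Equivalence using (to; from)

module _ {n : ℕ} where

  pair : Fin n → Fin n → Subset n
  pair a b = ⁅ a ⁆ ∪ ⁅ b ⁆

  x∈p∪⁅y⁆⁻ : ∀ {p : Subset n} {x y} → x ∈ p ∪ ⁅ y ⁆ → x ∈ p ⊎ x ≡ y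
  x∈p∪⁅y⁆⁻ {p} {y = y} = [ inj₁ , inj₂ ∘ x∈⁅y⁆⇒x≡y y ] ∘ x∈p∪q⁻ p ⁅ y ⁆

  x∈pair⁻ : ∀ {a b x : Fin n} → x ∈ pair a b → x ≡ a ⊎ x ≡ b
  x∈pair⁻ {a} = [ inj₁ ∘ x∈⁅y⁆⇒x≡y a , inj₂ ] ∘ x∈p∪⁅y⁆⁻

  a∈pair : ∀ a b → a ∈ pair a b
  a∈pair a b = x∈p∪q⁺ (inj₁ (x∈⁅x⁆ a))

  b∈pair : ∀ a b → b ∈ pair a b
  b∈pair a b = x∈p∪q⁺ (inj₂ (x∈⁅x⁆ b))

  pair⊆ : ∀ {a b} {p : Subset n} → a ∈ p → b ∈ p → pair a b ⊆ p
  pair⊆ a∈p b∈p x∈ab with x∈pair⁻ x∈ab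
  ... | inj₁ refl = a∈p
  ... | inj₂ refl = b∈p

  pair-swap : ∀ {a b} → pair a b ⊆ pair b a
  pair-swap {a} {b} = pair⊆ (b∈pair b a) (a∈pair b a)

  distinct∈pair : ∀ {a b x y : Fin n} → x ∈ pair a b → y ∈ pair a b → x ≢ y →
                   (x ≡ a × y ≡ b) ⊎ (x ≡ b × y ≡ a)
  distinct∈pair x∈ y∈ x≢y with x∈pair⁻ x∈ | x∈pair⁻ y∈
  ... | inj₁ refl | inj₁ refl = ⊥-elim (x≢y refl)
  ... | inj₁ x≡a  | inj₂ y≡b  = inj₁ (x≡a , y≡b)
  ... | inj₂ x≡b  | inj₁ y≡a  = inj₂ (x≡b , y≡a)
  ... | inj₂ refl | inj₂ refl = ⊥-elim (x≢y refl)

  ∈tabulate⁺ : ∀ {f : Fin n → _} {x} → T (f x) → x ∈ tabulate f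
  ∈tabulate⁺ {f} {x} t = lookup⇒[]= x _ (trans (lookup∘tabulate f x) (T-≡ .to t))

  ∈tabulate⁻ : ∀ {f : Fin n → _} {x} → x ∈ tabulate f → T (f x)
  ∈tabulate⁻ {f} {x} x∈ = T-≡ .from (trans (sym (lookup∘tabulate f x)) ([]=⇒lookup x∈))

x∉p-x : ∀ {n} (p : Subset n) x → x ∉ p - x
x∉p-x (s ∷ p) zero ()
x∉p-x (s ∷ p) (suc x) (there x∈) = x∉p-x p x x∈

p⊆q⇒p∪r⊆q∪r : ∀ {n} {p q r : Subset n} → p ⊆ q → p ∪ r ⊆ q ∪ r
p⊆q⇒p∪r⊆q∪r {p = p} {r = r} p⊆q = x∈p∪q⁺ ∘ [ inj₁ ∘ p⊆q , inj₂ ] ∘ x∈p∪q⁻ p r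

⊆pair⇒∪⁅⁆⊆ : ∀ {n} {p : Subset n} {a b w} → p ⊆ pair a b → p ∪ ⁅ w ⁆ ⊆ pair a w ∪ ⁅ b ⁆
⊆pair⇒∪⁅⁆⊆ {p = p} {a} {b} {w} p⊆ab x∈ with x∈p∪⁅y⁆⁻ x∈
... | inj₂ refl = x∈p∪q⁺ (inj₁ (b∈pair a w))
... | inj₁ x∈p with x∈pair⁻ (p⊆ab x∈p)
...   | inj₁ refl = x∈p∪q⁺ (inj₁ (a∈pair a w))
...   | inj₂ refl = x∈p∪q⁺ (inj₂ (x∈⁅x⁆ b))

cons-injective : ∀ {a} {A : Set a} {k} {f : Fin k → A} {x} →
                 Injective _≡_ _≡_ f → (∀ i → f i ≢ x) → Injective _≡_ _≡_ (x Vector.∷ f)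
cons-injective f-inj f≢x {zero}  {zero}  _  = refl
cons-injective f-inj f≢x {zero}  {suc j} eq = ⊥-elim (f≢x j (sym eq))
cons-injective f-inj f≢x {suc i} {zero}  eq = ⊥-elim (f≢x i eq)
cons-injective f-inj f≢x {suc i} {suc j} eq = cong suc (f-inj eq)

∣p∪q∣≤∣p∣+∣q∣ : ∀ {n} (p q : Subset n) → ∣ p ∪ q ∣ ≤ ∣ p ∣ + ∣ q ∣
∣p∪q∣≤∣p∣+∣q∣ [] [] = z≤n
∣p∪q∣≤∣p∣+∣q∣ (outside ∷ p) (outside ∷ q) = ∣p∪q∣≤∣p∣+∣q∣ p q
∣p∪q∣≤∣p∣+∣q∣ (inside ∷ p) (outside ∷ q) = s≤s (∣p∪q∣≤∣p∣+∣q∣ p q)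
∣p∪q∣≤∣p∣+∣q∣ (outside ∷ p) (inside ∷ q) =
  ≤-trans (s≤s (∣p∪q∣≤∣p∣+∣q∣ p q)) (≤-reflexive (sym (+-suc ∣ p ∣ ∣ q ∣)))
∣p∪q∣≤∣p∣+∣q∣ (inside ∷ p) (inside ∷ q) =
  s≤s (≤-trans (∣p∪q∣≤∣p∣+∣q∣ p q) (+-monoʳ-≤ ∣ p ∣ (n≤1+n ∣ q ∣)))

module _ {n : ℕ} where

  ∣pair∣≤2 : ∀ (a b : Fin n) → ∣ pair a b ∣ ≤ 2
  ∣pair∣≤2 a b = ≤-trans (∣p∪q∣≤∣p∣+∣q∣ ⁅ a ⁆ ⁅ b ⁆)
    (≤-reflexive (cong₂ _+_ (∣⁅x⁆∣≡1 a) (∣⁅x⁆∣≡1 b)))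

  length≤∣p∣ : ∀ {xs : List (Fin n)} {p} → Unique xs → All (_∈ p) xs → length xs ≤ ∣ p ∣
  length≤∣p∣ [] [] = z≤n
  length≤∣p∣ {p = p} (x≢xs ∷ xs-unique) (x∈p ∷ xs⊆p) =
    ≤-trans (s≤s (length≤∣p∣ xs-unique (All.zipWith xs⊆p-x (x≢xs , xs⊆p)))) (x∈p⇒∣p-x∣<∣p∣ x∈p)
    where
    xs⊆p-x : ∀ {x y} → x ≢ y × y ∈ p → y ∈ p - x
    xs⊆p-x (x≢y , y∈p) = x∈p∧x≢y⇒x∈p-y y∈p (x≢y ∘ sym)

  ∣p∣<n⇒∃∉ : ∀ {p : Subset n} → ∣ p ∣ ℕ.< n → ∃ λ x → x ∉ p
  ∣p∣<n⇒∃∉ {p} ∣p∣<n = ¬∀⟶∃¬ n (_∈ p) (_∈? p) λ all∈p →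
    ≤⇒≯ (subst (_≤ ∣ p ∣) (∣⊤∣≡n n) (p⊆q⇒∣p∣≤∣q∣ {p = ⊤} λ {x} _ → all∈p x)) ∣p∣<n

  x∉p⇒∣p∣<n : ∀ {p : Subset n} {x} → x ∉ p → ∣ p ∣ ℕ.< n
  x∉p⇒∣p∣<n {p} {x} x∉p =
    subst (∣ p ∣ ℕ.<_) (∣⊤∣≡n n) (p⊂q⇒∣p∣<∣q∣ {q = ⊤} ((λ _ → ∈⊤) , x , ∈⊤ , x∉p))

data AtMostTwo {n : ℕ} (X : Subset n) : Set where
  none   : Empty X → AtMostTwo X
  single : ∀ a → X ⊆ ⁅ a ⁆ → AtMostTwo X
  double : ∀ {a b} → a ∈ X → b ∈ X → a ≢ b → X ⊆ pair a b → AtMostTwo X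

AtMostTwo⇒∣X∣≤2 : ∀ {n} {X : Subset n} → AtMostTwo X → ∣ X ∣ ≤ 2
AtMostTwo⇒∣X∣≤2 {n} (none X-empty) =
  ≤-trans (≤-reflexive (trans (cong ∣_∣ (Empty-unique X-empty)) (∣⊥∣≡0 n))) z≤n
AtMostTwo⇒∣X∣≤2 (single a X⊆a) =
  ≤-trans (p⊆q⇒∣p∣≤∣q∣ X⊆a) (≤-trans (≤-reflexive (∣⁅x⁆∣≡1 a)) (s≤s z≤n))
AtMostTwo⇒∣X∣≤2 (double {a} {b} _ _ _ X⊆ab) = ≤-trans (p⊆q⇒∣p∣≤∣q∣ X⊆ab) (∣pair∣≤2 a b)

module _ {m n : ℕ} (M : BoolMatrix m n) where

  ∈Zrow⁺ : ∀ {r v} → M r v ≡ false → v ∈ Zrow M r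
  ∈Zrow⁺ Mrv≡false = ∈tabulate⁺ (T-not-≡ .from Mrv≡false)

  ∈Zrow⁻ : ∀ {r v} → v ∈ Zrow M r → M r v ≡ false
  ∈Zrow⁻ v∈Z = T-not-≡ .to (∈tabulate⁻ v∈Z)

  ∉Zrow⁺ : ∀ {r v} → M r v ≡ true → v ∉ Zrow M r
  ∉Zrow⁺ Mrv≡true v∈Z with trans (sym Mrv≡true) (∈Zrow⁻ v∈Z)
  ... | ()

  ∉Zrow⁻ : ∀ {r v} → v ∉ Zrow M r → M r v ≡ true
  ∉Zrow⁻ v∉Z = ¬-not (v∉Z ∘ ∈Zrow⁺)

  ΓM-sym : Symmetric (ΓM M)
  ΓM-sym (p≢q , r , line , p∈Z , q∈Z) = p≢q ∘ sym , r , line , q∈Z , p∈Z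

  ΓM-irrefl : ∀ {p} → ¬ ΓM M p p
  ΓM-irrefl (p≢p , _) = p≢p refl

  ΓM? : Decidable (ΓM M)
  ΓM? p q = ¬? (p ≟ q) ×-dec any? λ r →
    ((2 ℕ.≤? ∣ Zrow M r ∣) ×-dec (∣ Zrow M r ∣ ℕ.<? n)) ×-dec (p ∈? Zrow M r) ×-dec (q ∈? Zrow M r)

  -- Put the row r on top of a nonsingular submatrix for X and the column w in front:
  -- the zeros of r on X keep the new matrix lower unitriangular.
  MIndependent-∪⁅⁆ : ∀ {X r w} → MIndependent M X → X ⊆ Zrow M r → w ∉ Zrow M r →
                     MIndependent M (X ∪ ⁅ w ⁆)
  MIndependent-∪⁅⁆ {X} {r} {w} (k , f , g , f-inj , g-inj , columns , diagonal , above-diagonal) X⊆Z w∉Z =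
    ℕ.suc k , r Vector.∷ f , w Vector.∷ g ,
    cons-injective f-inj f≢r , cons-injective g-inj g≢w , columns′ , diagonal′ , above-diagonal′
    where
    r-vanishes : ∀ i → M r (g i) ≡ false
    r-vanishes i = ∈Zrow⁻ (X⊆Z (proj₂ (columns (g i)) (i , refl)))

    f≢r : ∀ i → f i ≢ r
    f≢r i refl with trans (sym (diagonal i)) (r-vanishes i)
    ... | ()

    g≢w : ∀ i → g i ≢ w
    g≢w i refl = ∉Zrow⁺ (∉Zrow⁻ w∉Z) (∈Zrow⁺ (r-vanishes i))

    column-of : ∀ {v} → v ∈ X ∪ ⁅ w ⁆ → ∃ λ i → (w Vector.∷ g) i ≡ v
    column-of {v} v∈ with x∈p∪⁅y⁆⁻ v∈
    ... | inj₁ v∈X = let i , gi≡v = proj₁ (columns v) v∈X in suc i , gi≡v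
    ... | inj₂ refl = zero , refl

    columns′ : ∀ v → (v ∈ X ∪ ⁅ w ⁆ → ∃ λ i → (w Vector.∷ g) i ≡ v) ×
                     ((∃ λ i → (w Vector.∷ g) i ≡ v) → v ∈ X ∪ ⁅ w ⁆)
    columns′ v = column-of , λ where
      (zero , refl)  → x∈p∪q⁺ (inj₂ (x∈⁅x⁆ w))
      (suc i , refl) → x∈p∪q⁺ (inj₁ (proj₂ (columns v) (i , refl)))

    diagonal′ : ∀ i → M ((r Vector.∷ f) i) ((w Vector.∷ g) i) ≡ true
    diagonal′ zero    = ∉Zrow⁻ w∉Z
    diagonal′ (suc i) = diagonal i

    above-diagonal′ : ∀ i j → i < j → M ((r Vector.∷ f) i) ((w Vector.∷ g) j) ≡ false
    above-diagonal′ zero    (suc j) _         = r-vanishes j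
    above-diagonal′ (suc i) (suc j) (s≤s i<j) = above-diagonal i j i<j

  -- In a nonsingular submatrix with at least three columns, the first row vanishes
  -- on the second and third columns but not on the first: its zero set is a line.
  independent⇒edge⊎AtMostTwo : ∀ {X} → MIndependent M X →
    (∃₂ λ p q → p ∈ X × q ∈ X × ΓM M p q) ⊎ AtMostTwo X
  independent⇒edge⊎AtMostTwo (0 , f , g , _ , _ , columns , _) =
    inj₂ (none λ (x , x∈X) → no-column (proj₁ (columns x) x∈X))
    where
    no-column : ∀ {x} → ¬ ∃ λ i → g i ≡ x
    no-column (() , _)
  independent⇒edge⊎AtMostTwo (1 , f , g , _ , _ , columns , _) =
    inj₂ (single (g zero) λ {x} x∈X → column-0 (proj₁ (columns x) x∈X))
    where
    column-0 : ∀ {x} → (∃ λ i → g i ≡ x) → x ∈ ⁅ g zero ⁆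
    column-0 (zero , refl) = x∈⁅x⁆ _
  independent⇒edge⊎AtMostTwo (2 , f , g , _ , g-inj , columns , _) =
    inj₂ (double (in-X zero) (in-X one) g0≢g1 λ {x} x∈X → column-0-or-1 (proj₁ (columns x) x∈X))
    where
    one : Fin 2
    one = suc zero
    in-X : ∀ i → g i ∈ _
    in-X i = proj₂ (columns (g i)) (i , refl)
    g0≢g1 : g zero ≢ g one
    g0≢g1 eq with g-inj eq
    ... | ()
    column-0-or-1 : ∀ {x} → (∃ λ i → g i ≡ x) → x ∈ pair (g zero) (g one)
    column-0-or-1 (zero , refl)     = a∈pair _ _
    column-0-or-1 (suc zero , refl) = b∈pair _ _
  independent⇒edge⊎AtMostTwo (ℕ.suc (ℕ.suc (ℕ.suc k)) , f , g , _ , g-inj , columns , diagonal , above-diagonal) =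
    inj₁ (g one , g two , in-X one , in-X two , g1≢g2 , f zero , (2≤∣Z∣ , x∉p⇒∣p∣<n g0∉Z) , g1∈Z , g2∈Z)
    where
    one two : Fin (ℕ.suc (ℕ.suc (ℕ.suc k)))
    one = suc zero
    two = suc (suc zero)
    in-X : ∀ i → g i ∈ _
    in-X i = proj₂ (columns (g i)) (i , refl)
    g1≢g2 : g one ≢ g two
    g1≢g2 eq with g-inj eq
    ... | ()
    g1∈Z = ∈Zrow⁺ (above-diagonal zero one (s≤s z≤n))
    g2∈Z = ∈Zrow⁺ (above-diagonal zero two (s≤s z≤n))
    g0∉Z = ∉Zrow⁺ (diagonal zero)
    2≤∣Z∣ : 2 ≤ ∣ Zrow M (f zero) ∣
    2≤∣Z∣ = length≤∣p∣ ((g1≢g2 ∷ []) ∷ [] ∷ []) (g1∈Z ∷ g2∈Z ∷ [])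

hub⇒connected : ∀ {n} {R : Graph n} → Symmetric R → ∀ c → (∀ x → Star R x c) → Connected R
hub⇒connected R-sym c to-hub x y = to-hub x ◅◅ reverse R-sym (to-hub y)

record IsCoveringAnticlique {n : ℕ} (E : Graph n) (F : Subset n) : Set where
  field
    anticlique : ∀ {a b} → a ∈ F → b ∈ F → ¬ E a b
    cover      : ∀ {w a b} → w ∉ F → a ∈ F → b ∈ F → a ≢ b → E a w ⊎ E b w

HasCoveringAnticlique : ∀ {n} → Graph n → Set
HasCoveringAnticlique E =
  ∃ λ F → IsCoveringAnticlique E F × ∃₂ λ a b → a ∈ F × b ∈ F × a ≢ b

Ω₁⇒HasCoveringAnticlique : ∀ {n} {E : Graph n} → Ω₁ E → HasCoveringAnticlique E
Ω₁⇒HasCoveringAnticlique {E = E} (z , A , (a , a∈A) , z∉A , isolated , A-anticlique , A-adjacent) =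
  A ∪ ⁅ z ⁆ , record { anticlique = anticlique ; cover = cover } ,
  a , z , x∈p∪q⁺ (inj₁ a∈A) , z∈F , λ { refl → z∉A a∈A }
  where
  z∈F : z ∈ A ∪ ⁅ z ⁆
  z∈F = x∈p∪q⁺ (inj₂ (x∈⁅x⁆ z))

  anticlique : ∀ {x y} → x ∈ A ∪ ⁅ z ⁆ → y ∈ A ∪ ⁅ z ⁆ → ¬ E x y
  anticlique x∈F y∈F with x∈p∪⁅y⁆⁻ x∈F | x∈p∪⁅y⁆⁻ y∈F
  ... | inj₁ x∈A  | inj₁ y∈A  = A-anticlique _ _ x∈A y∈A
  ... | inj₂ refl | _         = proj₁ (isolated _)
  ... | inj₁ _    | inj₂ refl = proj₂ (isolated _)

  adjacent : ∀ {x w} → x ∈ A → w ∉ A ∪ ⁅ z ⁆ → E x w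
  adjacent x∈A w∉F = A-adjacent _ _ x∈A (w∉F ∘ x∈p∪q⁺ ∘ inj₁) λ { refl → w∉F z∈F }

  cover : ∀ {w x y} → w ∉ A ∪ ⁅ z ⁆ → x ∈ A ∪ ⁅ z ⁆ → y ∈ A ∪ ⁅ z ⁆ → x ≢ y → E x w ⊎ E y w
  cover w∉F x∈F y∈F x≢y with x∈p∪⁅y⁆⁻ x∈F | x∈p∪⁅y⁆⁻ y∈F
  ... | inj₁ x∈A  | _         = inj₁ (adjacent x∈A w∉F)
  ... | inj₂ refl | inj₁ y∈A  = inj₂ (adjacent y∈A w∉F)
  ... | inj₂ refl | inj₂ refl = ⊥-elim (x≢y refl)

module _ {n : ℕ} {E : Graph n} (E-sym : Symmetric E) (E-irrefl : ∀ {x} → ¬ E x x) where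

  Ω₂⇒HasCoveringAnticlique : Ω₂ E → HasCoveringAnticlique E
  Ω₂⇒HasCoveringAnticlique (B , b , c , b∈B , c∉B , separated , b-centre , c-centre) =
    pair b c , record { anticlique = anticlique ; cover = cover } ,
    b , c , a∈pair b c , b∈pair b c , λ { refl → c∉B b∈B }
    where
    anticlique : ∀ {x y} → x ∈ pair b c → y ∈ pair b c → ¬ E x y
    anticlique x∈F y∈F with x∈pair⁻ x∈F | x∈pair⁻ y∈F
    ... | inj₁ refl | inj₁ refl = E-irrefl
    ... | inj₁ refl | inj₂ refl = proj₁ (separated b c b∈B c∉B)
    ... | inj₂ refl | inj₁ refl = proj₂ (separated b c b∈B c∉B)
    ... | inj₂ refl | inj₂ refl = E-irrefl

    b-or-c : ∀ {w} → w ∉ pair b c → E b w ⊎ E c w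
    b-or-c {w} w∉F with w ∈? B
    ... | yes w∈B = inj₁ (b-centre w w∈B λ { refl → w∉F (a∈pair b c) })
    ... | no  w∉B = inj₂ (c-centre w w∉B λ { refl → w∉F (b∈pair b c) })

    cover : ∀ {w x y} → w ∉ pair b c → x ∈ pair b c → y ∈ pair b c → x ≢ y → E x w ⊎ E y w
    cover w∉F x∈F y∈F x≢y with distinct∈pair x∈F y∈F x≢y
    ... | inj₁ (refl , refl) = b-or-c w∉F
    ... | inj₂ (refl , refl) = [ inj₂ , inj₁ ] (b-or-c w∉F)

  pair∪⁅w⁆-edge : ∀ {a b w x y} → (∀ {x y} → x ∈ pair a b → y ∈ pair a b → ¬ E x y) →
                  x ∈ pair a b ∪ ⁅ w ⁆ → y ∈ pair a b ∪ ⁅ w ⁆ → E x y → E a w ⊎ E b w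
  pair∪⁅w⁆-edge anticlique x∈ y∈ e with x∈p∪⁅y⁆⁻ x∈ | x∈p∪⁅y⁆⁻ y∈
  ... | inj₁ x∈ab | inj₁ y∈ab = ⊥-elim (anticlique x∈ab y∈ab e)
  ... | inj₂ refl | inj₂ refl = ⊥-elim (E-irrefl e)
  ... | inj₁ x∈ab | inj₂ refl with x∈pair⁻ x∈ab
  ...   | inj₁ refl = inj₁ e
  ...   | inj₂ refl = inj₂ e
  pair∪⁅w⁆-edge anticlique x∈ y∈ e | inj₂ refl | inj₁ y∈ab with x∈pair⁻ y∈ab
  ...   | inj₁ refl = inj₁ (E-sym e)
  ...   | inj₂ refl = inj₂ (E-sym e)

  module _ {F : Subset n} (F-covering : IsCoveringAnticlique E F) where

    open IsCoveringAnticlique F-covering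

    isolated⇒Ω₁ : ∀ {x z} → x ∈ F → z ∈ F → x ≢ z → (∀ u → ¬ E z u) → Ω₁ E
    isolated⇒Ω₁ {x} {z} x∈F z∈F x≢z isolated =
      z , F - z , (x , x∈p∧x≢y⇒x∈p-y x∈F x≢z) , x∉p-x F z ,
      (λ u → isolated u , isolated u ∘ E-sym) ,
      (λ a b a∈A b∈A → anticlique (p─q⊆p F _ a∈A) (p─q⊆p F _ b∈A)) ,
      adjacent
      where
      adjacent : ∀ a d → a ∈ F - z → d ∉ F - z → d ≢ z → E a d
      adjacent a d a∈A d∉A d≢z with d ∈? F
      ... | yes d∈F = ⊥-elim (d∉A (x∈p∧x≢y⇒x∈p-y d∈F d≢z))
      ... | no  d∉F = [ id , ⊥-elim ∘ isolated d ]
                        (cover d∉F (p─q⊆p F _ a∈A) z∈F λ { refl → x∉p-x F a a∈A })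

  module _ (E? : Decidable E) where

    N[_] : Fin n → Subset n
    N[ p ] = ⁅ p ⁆ ∪ tabulate (isYes ∘ E? p)

    p∈N[p] : ∀ p → p ∈ N[ p ]
    p∈N[p] p = x∈p∪q⁺ (inj₁ (x∈⁅x⁆ p))

    ∈N⁺ : ∀ {p x} → E p x → x ∈ N[ p ]
    ∈N⁺ px = x∈p∪q⁺ (inj₂ (∈tabulate⁺ (fromWitness px)))

    ∈N⁻ : ∀ {p x} → x ∈ N[ p ] → x ≡ p ⊎ E p x
    ∈N⁻ {p} x∈N with x∈p∪q⁻ ⁅ p ⁆ _ x∈N
    ... | inj₁ x∈p = inj₁ (x∈⁅y⁆⇒x≡y p x∈p)
    ... | inj₂ x∈E = inj₂ (toWitness (∈tabulate⁻ x∈E))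

    ¬isolated⇒neighbour : ∀ {x} → ¬ (∀ u → ¬ E x u) → ∃ λ u → E x u
    ¬isolated⇒neighbour {x} ¬isolated with ¬∀⟶∃¬ n (λ u → ¬ E x u) (λ u → ¬? (E? x u)) ¬isolated
    ... | u , ¬¬xu = u , decidable-stable (E? x u) ¬¬xu

    module _ {F : Subset n} (F-covering : IsCoveringAnticlique E F) where

      open IsCoveringAnticlique F-covering

      -- Any two outside vertices are each adjacent to two of p, q, r, hence to a common one.
      three-nonisolated⇒connected : ∀ {p q r v} → p ∈ F → q ∈ F → r ∈ F →
        p ≢ q → p ≢ r → q ≢ r → (∀ {x} → x ∈ F → ∃ λ u → E x u) → v ∉ F → Connected E
      three-nonisolated⇒connected {p} {q} {r} {v} p∈F q∈F r∈F p≢q p≢r q≢r neighbour v∉F =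
        hub⇒connected E-sym v to-v
        where
        resolve : ∀ {A B : Set} → A ⊎ B → ¬ A → B
        resolve (inj₁ a) ¬a = ⊥-elim (¬a a)
        resolve (inj₂ b) _  = b

        common-neighbour : ∀ {w w′} → w ∉ F → w′ ∉ F → ∃ λ c → E c w × E c w′
        common-neighbour {w} {w′} w∉F w′∉F with E? p w | E? p w′
        ... | yes pw | yes pw′ = p , pw , pw′
        ... | no ¬pw | _ with cover w′∉F q∈F r∈F q≢r
        ...   | inj₁ qw′ = q , resolve (cover w∉F p∈F q∈F p≢q) ¬pw , qw′
        ...   | inj₂ rw′ = r , resolve (cover w∉F p∈F r∈F p≢r) ¬pw , rw′
        common-neighbour {w} {w′} w∉F w′∉F | yes _ | no ¬pw′ with cover w∉F q∈F r∈F q≢r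
        ...   | inj₁ qw = q , qw , resolve (cover w′∉F p∈F q∈F p≢q) ¬pw′
        ...   | inj₂ rw = r , rw , resolve (cover w′∉F p∈F r∈F p≢r) ¬pw′

        outside-to-v : ∀ {w} → w ∉ F → Star E w v
        outside-to-v w∉F with common-neighbour w∉F v∉F
        ... | _ , cw , cv = E-sym cw ◅ cv ◅ ε

        to-v : ∀ x → Star E x v
        to-v x with x ∈? F
        ... | no x∉F = outside-to-v x∉F
        ... | yes x∈F with neighbour x∈F
        ...   | u , xu with u ∈? F
        ...     | yes u∈F = ⊥-elim (anticlique x∈F u∈F xu)
        ...     | no  u∉F = xu ◅ outside-to-v u∉F

      module _ {p q} (p∈F : p ∈ F) (q∈F : q ∈ F) (p≢q : p ≢ q)
               (F⊆pq : ∀ {x} → x ∈ F → x ≡ p ⊎ x ≡ q) where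

        q∉N[p] : q ∉ N[ p ]
        q∉N[p] q∈N with ∈N⁻ q∈N
        ... | inj₁ q≡p = p≢q (sym q≡p)
        ... | inj₂ pq  = anticlique p∈F q∈F pq

        p-centre : ∀ u → u ∈ N[ p ] → u ≢ p → E p u
        p-centre u u∈N u≢p with ∈N⁻ u∈N
        ... | inj₁ u≡p = ⊥-elim (u≢p u≡p)
        ... | inj₂ pu  = pu

        q-centre : ∀ u → u ∉ N[ p ] → u ≢ q → E q u
        q-centre u u∉N u≢q with u ∈? F
        ... | yes u∈F = ⊥-elim ([ (λ { refl → u∉N (p∈N[p] p) }) , u≢q ] (F⊆pq u∈F))
        ... | no  u∉F = [ (λ pu → ⊥-elim (u∉N (∈N⁺ pu))) , (λ qu → qu) ] (cover u∉F p∈F q∈F p≢q)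

        inside-to-p : ∀ {x} → x ∈ N[ p ] → Star E x p
        inside-to-p x∈N with ∈N⁻ x∈N
        ... | inj₁ refl = ε
        ... | inj₂ px   = E-sym px ◅ ε

        outside-to-q : ∀ {x} → x ∉ N[ p ] → Star E x q
        outside-to-q {x} x∉N with x ≟ q
        ... | yes refl = ε
        ... | no  x≢q  = E-sym (q-centre x x∉N x≢q) ◅ ε

        -- Either an edge leaves N[ p ], or N[ p ] and its complement split E as in Ω₂.
        pair⇒connected⊎Ω₂ : Connected E ⊎ Ω₂ E
        pair⇒connected⊎Ω₂
          with any? (λ u → any? λ w → (u ∈? N[ p ]) ×-dec ¬? (w ∈? N[ p ]) ×-dec E? u w)
        ... | yes (u , w , u∈N , w∉N , uw) = inj₁ (hub⇒connected E-sym p to-p)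
          where
          q-to-p : Star E q p
          q-to-p = reverse E-sym (outside-to-q w∉N) ◅◅ E-sym uw ◅ inside-to-p u∈N

          to-p : ∀ x → Star E x p
          to-p x with x ∈? N[ p ]
          ... | yes x∈N = inside-to-p x∈N
          ... | no  x∉N = outside-to-q x∉N ◅◅ q-to-p
        ... | no no-crossing =
          inj₂ (N[ p ] , p , q , p∈N[p] p , q∉N[p] , separated , p-centre , q-centre)
          where
          separated : ∀ u w → u ∈ N[ p ] → w ∉ N[ p ] → ¬ E u w × ¬ E w u
          separated u w u∈N w∉N = (λ uw → no-crossing (u , w , u∈N , w∉N , uw)) ,
                                  (λ wu → no-crossing (u , w , u∈N , w∉N , E-sym wu))

      module _ {p q v} (p∈F : p ∈ F) (q∈F : q ∈ F) (p≢q : p ≢ q) (v∉F : v ∉ F) where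

        isolated-in⇒Ω₁ : ∀ {z} → z ∈ F → (∀ u → ¬ E z u) → Ω₁ E
        isolated-in⇒Ω₁ {z} z∈F isolated with p ≟ z
        ... | yes refl = isolated⇒Ω₁ F-covering q∈F z∈F (p≢q ∘ sym) isolated
        ... | no  p≢z  = isolated⇒Ω₁ F-covering p∈F z∈F p≢z isolated

        no-third⇒⊆pair : ¬ (∃ λ r → r ∈ F × r ≢ p × r ≢ q) → ∀ {x} → x ∈ F → x ≡ p ⊎ x ≡ q
        no-third⇒⊆pair no-third {x} x∈F with x ≟ p | x ≟ q
        ... | yes x≡p | _       = inj₁ x≡p
        ... | no  _   | yes x≡q = inj₂ x≡q
        ... | no  x≢p | no  x≢q = ⊥-elim (no-third (x , x∈F , x≢p , x≢q))

        coveringAnticlique⇒connected⊎Ω : Connected E ⊎ Ω₁ E ⊎ Ω₂ E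
        coveringAnticlique⇒connected⊎Ω
          with any? (λ z → (z ∈? F) ×-dec all? (λ u → ¬? (E? z u)))
        ... | yes (z , z∈F , isolated) = inj₂ (inj₁ (isolated-in⇒Ω₁ z∈F isolated))
        ... | no no-isolated
          with any? (λ r → (r ∈? F) ×-dec ¬? (r ≟ p) ×-dec ¬? (r ≟ q))
        ...   | yes (r , r∈F , r≢p , r≢q) =
                inj₁ (three-nonisolated⇒connected p∈F q∈F r∈F p≢q (r≢p ∘ sym) (r≢q ∘ sym)
                        (λ x∈F → ¬isolated⇒neighbour λ isolated → no-isolated (_ , x∈F , isolated)) v∉F)
        ...   | no no-third =
                [ inj₁ , inj₂ ∘ inj₂ ] (pair⇒connected⊎Ω₂ p∈F q∈F p≢q (no-third⇒⊆pair no-third))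

module _ {n : ℕ} (K : SimplicialComplex n) where

  pair-face : IsSimple K → ∀ a b → H K (pair a b)
  pair-face simple a b with a ≟ b
  ... | yes refl = downClosed K (pair⊆ (x∈⁅x⁆ a) (x∈⁅x⁆ a)) (singletons K a)
  ... | no  a≢b  = simple a b a≢b

  flat-edge : ∀ {F p q v} → IsFlat K F → p ∈ F → q ∈ F → p ≢ q → v ∉ F → ΓFl K p q
  flat-edge F-flat p∈F q∈F p≢q v∉F = p≢q , λ spanning → v∉F (spanning _ _ F-flat (pair⊆ p∈F q∈F))

  ΓFl-sym : Symmetric (ΓFl K)
  ΓFl-sym (p≢q , ¬spanning) =
    p≢q ∘ sym , λ spanning → ¬spanning λ v F F-flat qp⊆F → spanning v F F-flat (qp⊆F ∘ pair-swap)

module Representation {m n : ℕ} (K : SimplicialComplex n) (M : BoolMatrix m n) (rep : Represents M K) where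

  extend-face : ∀ {I r w} → H K I → I ⊆ Zrow M r → w ∉ Zrow M r → H K (I ∪ ⁅ w ⁆)
  extend-face I-face I⊆Z w∉Z = proj₂ (rep _) (MIndependent-∪⁅⁆ M (proj₁ (rep _) I-face) I⊆Z w∉Z)

  Zrow-isFlat : ∀ r → IsFlat K (Zrow M r)
  Zrow-isFlat r I I-face I⊆Z w w∉Z = extend-face I-face I⊆Z w∉Z

  ΓM⊆ΓFl : ∀ {p q} → ΓM M p q → ΓFl K p q
  ΓM⊆ΓFl (p≢q , r , (_ , ∣Z∣<n) , p∈Z , q∈Z) =
    flat-edge K (Zrow-isFlat r) p∈Z q∈Z p≢q (proj₂ (∣p∣<n⇒∃∉ ∣Z∣<n))

  face⇒edge⊎AtMostTwo : ∀ {X} → H K X → (∃₂ λ p q → p ∈ X × q ∈ X × ΓM M p q) ⊎ AtMostTwo X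
  face⇒edge⊎AtMostTwo X-face = independent⇒edge⊎AtMostTwo M (proj₁ (rep _) X-face)

  3≤∣face∣⇒edge : ∀ {X} → H K X → 3 ≤ ∣ X ∣ → ∃₂ λ p q → p ∈ X × q ∈ X × ΓM M p q
  3≤∣face∣⇒edge X-face 3≤∣X∣ with face⇒edge⊎AtMostTwo X-face
  ... | inj₁ edge      = edge
  ... | inj₂ at-most-2 = ⊥-elim (≤⇒≯ (AtMostTwo⇒∣X∣≤2 at-most-2) 3≤∣X∣)

  anticlique⇒∃∉ : HasDimension K 2 → ∀ {F} → (∀ {a b} → a ∈ F → b ∈ F → ¬ ΓM M a b) → ∃ λ v → v ∉ F
  anticlique⇒∃∉ ((I , I-face , ∣I∣≡3) , _) {F} anticlique =
    ¬∀⟶∃¬ n (_∈ F) (_∈? F) λ all∈F →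
      let _ , _ , _ , _ , pq = 3≤∣face∣⇒edge I-face (≤-reflexive (sym ∣I∣≡3))
      in anticlique (all∈F _) (all∈F _) pq

  module _ (simple : IsSimple K) where

    line-triangle : ∀ {r a b c} → a ∈ Zrow M r → b ∈ Zrow M r → c ∉ Zrow M r → H K (pair a b ∪ ⁅ c ⁆)
    line-triangle a∈Z b∈Z c∉Z = extend-face (pair-face K simple _ _) (pair⊆ a∈Z b∈Z) c∉Z

    anticlique-triangle : ∀ {F a b w} → (∀ {x y} → x ∈ F → y ∈ F → ¬ ΓM M x y) →
      a ∈ F → b ∈ F → a ≢ b → ΓM M a w → H K (pair a w ∪ ⁅ b ⁆)
    anticlique-triangle anticlique a∈F b∈F a≢b (_ , r , line , a∈Z , w∈Z) =
      line-triangle a∈Z w∈Z λ b∈Z → anticlique a∈F b∈F (a≢b , r , line , a∈Z , b∈Z)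

    coveringAnticlique⇒isFlat : ∀ {F} → IsCoveringAnticlique (ΓM M) F → IsFlat K F
    coveringAnticlique⇒isFlat {F} F-covering I I-face I⊆F w w∉F = extend (face⇒edge⊎AtMostTwo I-face)
      where
      open IsCoveringAnticlique F-covering

      extend : (∃₂ λ p q → p ∈ I × q ∈ I × ΓM M p q) ⊎ AtMostTwo I → H K (I ∪ ⁅ w ⁆)
      extend (inj₁ (_ , _ , p∈I , q∈I , pq)) = ⊥-elim (anticlique (I⊆F p∈I) (I⊆F q∈I) pq)
      extend (inj₂ (none I-empty)) = extend (inj₂ (single w λ x∈I → ⊥-elim (I-empty (_ , x∈I))))
      extend (inj₂ (single a I⊆a)) = downClosed K (p⊆q⇒p∪r⊆q∪r I⊆a) (pair-face K simple a w)
      extend (inj₂ (double a∈I b∈I a≢b I⊆ab)) with cover w∉F (I⊆F a∈I) (I⊆F b∈I) a≢b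
      ... | inj₁ aw = downClosed K (⊆pair⇒∪⁅⁆⊆ I⊆ab)
                        (anticlique-triangle anticlique (I⊆F a∈I) (I⊆F b∈I) a≢b aw)
      ... | inj₂ bw = downClosed K (⊆pair⇒∪⁅⁆⊆ (pair-swap ∘ I⊆ab))
                        (anticlique-triangle anticlique (I⊆F b∈I) (I⊆F a∈I) (a≢b ∘ sym) bw)

    module _ (dim : HasDimension K 2) where

      proper-flat-triangle-free : ∀ {F v a b c} → IsFlat K F → v ∉ F → a ∈ F → b ∈ F → c ∈ F →
        a ≢ b → a ≢ c → b ≢ c → ¬ H K (pair a b ∪ ⁅ c ⁆)
      proper-flat-triangle-free {F} {v} {a} {b} {c} F-flat v∉F a∈F b∈F c∈F a≢b a≢c b≢c T-face =
        ≤⇒≯ (proj₂ dim _ (F-flat _ T-face T⊆F v v∉F)) 4≤∣T∪v∣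
        where
        T⊆F : pair a b ∪ ⁅ c ⁆ ⊆ F
        T⊆F x∈ with x∈p∪⁅y⁆⁻ x∈
        ... | inj₁ x∈ab = pair⊆ a∈F b∈F x∈ab
        ... | inj₂ refl = c∈F

        ≢v : ∀ {x} → x ∈ F → x ≢ v
        ≢v x∈F refl = v∉F x∈F

        in-T∪v : ∀ {x} → x ∈ pair a b ∪ ⁅ c ⁆ → x ∈ (pair a b ∪ ⁅ c ⁆) ∪ ⁅ v ⁆
        in-T∪v = x∈p∪q⁺ ∘ inj₁

        4≤∣T∪v∣ : 4 ≤ ∣ (pair a b ∪ ⁅ c ⁆) ∪ ⁅ v ⁆ ∣
        4≤∣T∪v∣ = length≤∣p∣
          ((a≢b ∷ a≢c ∷ ≢v a∈F ∷ []) ∷ (b≢c ∷ ≢v b∈F ∷ []) ∷ (≢v c∈F ∷ []) ∷ [] ∷ [])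
          ( in-T∪v (x∈p∪q⁺ (inj₁ (a∈pair a b))) ∷ in-T∪v (x∈p∪q⁺ (inj₁ (b∈pair a b)))
          ∷ in-T∪v (x∈p∪q⁺ (inj₂ (x∈⁅x⁆ c))) ∷ x∈p∪q⁺ (inj₂ (x∈⁅x⁆ v)) ∷ [])

      proper-flat⇒coveringAnticlique : ∀ {F v p q} → IsFlat K F → v ∉ F → p ∈ F → q ∈ F →
        p ≢ q → ¬ ΓM M p q → IsCoveringAnticlique (ΓM M) F
      proper-flat⇒coveringAnticlique {F} {v} {p} {q} F-flat v∉F p∈F q∈F p≢q ¬pq =
        record { anticlique = anticlique ; cover = cover }
        where
        anticlique : ∀ {a b} → a ∈ F → b ∈ F → ¬ ΓM M a b
        anticlique {a} {b} a∈F b∈F (a≢b , r , line , a∈Z , b∈Z) =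
          ¬pq (p≢q , r , line , F⊆Z p∈F , F⊆Z q∈F)
          where
          F⊆Z : F ⊆ Zrow M r
          F⊆Z {x} x∈F with x ∈? Zrow M r
          ... | yes x∈Z = x∈Z
          ... | no  x∉Z = ⊥-elim (proper-flat-triangle-free F-flat v∉F a∈F b∈F x∈F a≢b
                                   (λ { refl → x∉Z a∈Z }) (λ { refl → x∉Z b∈Z })
                                   (line-triangle a∈Z b∈Z x∉Z))

        cover : ∀ {w a b} → w ∉ F → a ∈ F → b ∈ F → a ≢ b → ΓM M a w ⊎ ΓM M b w
        cover {w} {a} {b} w∉F a∈F b∈F a≢b with 3≤∣face∣⇒edge abw-face 3≤∣abw∣
          where
          abw-face : H K (pair a b ∪ ⁅ w ⁆)
          abw-face = F-flat _ (pair-face K simple a b) (pair⊆ a∈F b∈F) w w∉F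

          ≢w : ∀ {x} → x ∈ F → x ≢ w
          ≢w x∈F refl = w∉F x∈F

          3≤∣abw∣ : 3 ≤ ∣ pair a b ∪ ⁅ w ⁆ ∣
          3≤∣abw∣ = length≤∣p∣ ((a≢b ∷ ≢w a∈F ∷ []) ∷ (≢w b∈F ∷ []) ∷ [] ∷ [])
            ( x∈p∪q⁺ (inj₁ (a∈pair a b)) ∷ x∈p∪q⁺ (inj₁ (b∈pair a b))
            ∷ x∈p∪q⁺ (inj₂ (x∈⁅x⁆ w)) ∷ [])
        ... | _ , _ , x∈ , y∈ , xy = pair∪⁅w⁆-edge (ΓM-sym M) (ΓM-irrefl M)
          (λ x∈ab y∈ab → anticlique (pair⊆ a∈F b∈F x∈ab) (pair⊆ a∈F b∈F y∈ab)) x∈ y∈ xy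

      coveringAnticlique⇒ΓFl-connected : ∀ {F a b} → IsCoveringAnticlique (ΓM M) F →
        a ∈ F → b ∈ F → a ≢ b → Connected (ΓFl K)
      coveringAnticlique⇒ΓFl-connected {F} {a} {b} F-covering a∈F b∈F a≢b =
        hub⇒connected (ΓFl-sym K) a to-a
        where
        open IsCoveringAnticlique F-covering
        F-flat = coveringAnticlique⇒isFlat F-covering
        v∉F = proj₂ (anticlique⇒∃∉ dim anticlique)

        within-F : ∀ {x y} → x ∈ F → y ∈ F → x ≢ y → Star (ΓFl K) x y
        within-F x∈F y∈F x≢y = flat-edge K F-flat x∈F y∈F x≢y v∉F ◅ ε

        to-a : ∀ x → Star (ΓFl K) x a
        to-a x with x ≟ a | x ∈? F
        ... | yes refl | _ = ε
        ... | no x≢a | yes x∈F = within-F x∈F a∈F x≢a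
        ... | no _   | no x∉F with cover x∉F a∈F b∈F a≢b
        ...   | inj₁ ax = ΓFl-sym K (ΓM⊆ΓFl ax) ◅ ε
        ...   | inj₂ bx = ΓFl-sym K (ΓM⊆ΓFl bx) ◅ within-F b∈F a∈F (a≢b ∘ sym)

      nonadjacent⇒spanning : ¬ Connected (ΓM M) → ¬ Ω₁ (ΓM M) → ¬ Ω₂ (ΓM M) →
        ∀ {p q} → p ≢ q → ¬ ΓM M p q → ∀ v → v ∈cl[ K ] pair p q
      nonadjacent⇒spanning ¬connected ¬Ω₁ ¬Ω₂ p≢q ¬pq v F F-flat pq⊆F with v ∈? F
      ... | yes v∈F = v∈F
      ... | no  v∉F =
        ⊥-elim ([ ¬connected , [ ¬Ω₁ , ¬Ω₂ ] ]
          (coveringAnticlique⇒connected⊎Ω (ΓM-sym M) (ΓM-irrefl M) (ΓM? M)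
            (proper-flat⇒coveringAnticlique F-flat v∉F p∈F q∈F p≢q ¬pq) p∈F q∈F p≢q v∉F))
        where
        p∈F = pq⊆F (a∈pair _ _)
        q∈F = pq⊆F (b∈pair _ _)

theorem7p6 : ∀ {m n} (K : SimplicialComplex n) (M : BoolMatrix m n) →
    IsSimple K → HasDimension K 2 → Represents M K →
    ((Connected (ΓM M) ⊎ Ω₁ (ΓM M) ⊎ Ω₂ (ΓM M)) → Connected (ΓFl K)) ×
    (¬ Connected (ΓM M) → ¬ Ω₁ (ΓM M) → ¬ Ω₂ (ΓM M) → ΓFl K ≅ ΓM M)
theorem7p6 K M simple dim rep = connected-cases , ΓFl≅ΓM
  where
  open Representation K M rep

  Ω⇒covering : Ω₁ (ΓM M) ⊎ Ω₂ (ΓM M) → HasCoveringAnticlique (ΓM M)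
  Ω⇒covering = [ Ω₁⇒HasCoveringAnticlique , Ω₂⇒HasCoveringAnticlique (ΓM-sym M) (ΓM-irrefl M) ]

  connected-cases : Connected (ΓM M) ⊎ Ω₁ (ΓM M) ⊎ Ω₂ (ΓM M) → Connected (ΓFl K)
  connected-cases (inj₁ connected) p q = Star-map (ΓM⊆ΓFl) (connected p q)
  connected-cases (inj₂ Ω) with Ω⇒covering Ω
  ... | _ , F-covering , _ , _ , a∈F , b∈F , a≢b =
    coveringAnticlique⇒ΓFl-connected simple dim F-covering a∈F b∈F a≢b

  ΓFl≅ΓM : ¬ Connected (ΓM M) → ¬ Ω₁ (ΓM M) → ¬ Ω₂ (ΓM M) → ΓFl K ≅ ΓM M
  ΓFl≅ΓM ¬connected ¬Ω₁ ¬Ω₂ p q = ΓFl⇒ΓM , ΓM⊆ΓFl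
    where
    ΓFl⇒ΓM : ΓFl K p q → ΓM M p q
    ΓFl⇒ΓM (p≢q , ¬spanning) = decidable-stable (ΓM? M p q) λ ¬pq →
      ¬spanning (nonadjacent⇒spanning simple dim ¬connected ¬Ω₁ ¬Ω₂ p≢q ¬pq)
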